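{- For every positive rational number $q$, $$\sum_{d \in \mathbb{N}:\ \sigma(d)/d = q} \frac{1}{d} \leq 1,$$ where $\sigma(d) = \sum_{e \mid d} e$ is the sum of divisors function. -}

module Defs where

open import Data.Nat using (ℕ; zero; suc)
open import Data.Nat.Divisibility using (_∣?_)
open import Data.List using (List; filter; applyUpTo; map; foldr)
open import Data.Nat.ListAction using (sum)
open import Data.Integer using (+_)
open import Data.Rational using (ℚ; 0ℚ; _/_; _+_)

-- σ(d) = sum of the positive divisors of d  (σ 0 = 0 by this convention; unused)
σ : ℕ → ℕ
σ d = sum (filter (_∣? d) (applyUpTo suc d))

-- abundancy σ(d)/d as a rational; only used for d ≥ 1 (value at 0 is a dummy)
abundancy : ℕ → ℚ
abundancy zero = 0ℚ
abundancy (suc n) = (+ σ (suc n)) / suc n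

-- reciprocal 1/d as a rational; only used for d ≥ 1
recip : ℕ → ℚ
recip zero = 0ℚ
recip (suc n) = (+ 1) / suc n

sumℚ : List ℚ → ℚ
sumℚ = foldr _+_ 0ℚ

-- Fix the ratio σ(d)/d = A/B. By induction on a bound n for d we show that distinct m-rough
-- solutions d ≥ 2 have Σ 1/d ≤ 1/(m - 1); allowing d = 1 gives Σ 1/d ≤ 1, since 1 is a solution
-- only when A = B, and then it is the only one. Write d = pᵏ⁺¹ d′ with p the least prime factor
-- of d, so that d′ solves σ(d′)/d′ = A pᵏ⁺¹ / (B σ(pᵏ⁺¹)) with smaller d′.
-- If some solution is a prime power pᵏ⁺¹, then σ(pᵏ⁺¹) is prime to p, so p divides every
-- solution; by induction the cofactors of exponent k contribute at most 1/pᵏ⁺¹, in total at most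
-- 1/(p - 1) ≤ 1/(m - 1). Otherwise the cofactors for fixed (p, k) are (p + 1)-rough solutions ≥ 2,
-- contributing at most 1/(pᵏ⁺¹ p); summing over k and then over p ≥ m gives
-- Σ_{p ≥ m} 1/(p (p - 1)) = 1/(m - 1).
module Submission where

open import Defs
open import Data.Empty using (⊥-elim)
open import Data.List using (List; []; _∷_; map; filter)
open import Data.List.Relation.Unary.All as All using (All; []; _∷_)
open import Data.List.Relation.Unary.Unique.Propositional using (Unique; _∷_)
open import Data.Nat using (ℕ)
open import Data.Product using (∃; ∃-syntax; _×_; _,_; proj₁; proj₂)
open import Data.Sum using (inj₁; inj₂)
open import Function using (_∘_)
open import Level using (0ℓ)
open import Relation.Binary.PropositionalEquality
open import Relation.Nullary using (Dec; yes; no; does; ¬_; ¬?)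
open import Relation.Unary using (Pred; Decidable)

module DivisorSum where

  open import Data.Bool using (if_then_else_)
  open import Data.List using (applyUpTo; _++_)
  open import Data.List.Properties using (applyUpTo-∷ʳ; filter-++)
  open import Data.Nat
  open import Data.Nat.Coprimality using (Coprime; coprime-divisor)
  open import Data.Nat.Divisibility
  open import Data.Nat.ListAction using (sum)
  open import Data.Nat.ListAction.Properties using (sum-++)
  open import Data.Nat.Primality
  open import Data.Nat.Properties
  open import Data.Nat.Tactic.RingSolver using (solve-∀)

  rangeSum : (ℕ → ℕ) → ℕ → ℕ
  rangeSum w zero    = 0
  rangeSum w (suc n) = rangeSum w n + w (suc n)

  rangeSum-cong : ∀ {w v} n → (∀ e → w e ≡ v e) → rangeSum w n ≡ rangeSum v n
  rangeSum-cong zero    w≗v = refl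
  rangeSum-cong (suc n) w≗v = cong₂ _+_ (rangeSum-cong n w≗v) (w≗v (suc n))

  rangeSum-+ : ∀ w v n → rangeSum (λ e → w e + v e) n ≡ rangeSum w n + rangeSum v n
  rangeSum-+ w v zero    = refl
  rangeSum-+ w v (suc n) = begin
    rangeSum (λ e → w e + v e) n + (w (suc n) + v (suc n))
      ≡⟨ cong (_+ (w (suc n) + v (suc n))) (rangeSum-+ w v n) ⟩
    (rangeSum w n + rangeSum v n) + (w (suc n) + v (suc n))
      ≡⟨ +-+-comm (rangeSum w n) (rangeSum v n) _ _ ⟩
    rangeSum w (suc n) + rangeSum v (suc n) ∎
    where
    open ≡-Reasoning
    +-+-comm : ∀ a b c d → (a + b) + (c + d) ≡ (a + c) + (b + d)
    +-+-comm = solve-∀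

  rangeSum-* : ∀ c w n → rangeSum (λ e → c * w e) n ≡ c * rangeSum w n
  rangeSum-* c w zero    = sym (*-zeroʳ c)
  rangeSum-* c w (suc n) = begin
    rangeSum (λ e → c * w e) n + c * w (suc n) ≡⟨ cong (_+ c * w (suc n)) (rangeSum-* c w n) ⟩
    c * rangeSum w n + c * w (suc n)           ≡⟨ *-distribˡ-+ c (rangeSum w n) (w (suc n)) ⟨
    c * rangeSum w (suc n)                     ∎
    where open ≡-Reasoning

  rangeSum-vanishing : ∀ w n t → (∀ e → n < e → e ≤ n + t → w e ≡ 0) → rangeSum w (n + t) ≡ rangeSum w n
  rangeSum-vanishing w n zero    w≡0 = cong (rangeSum w) (+-identityʳ n)
  rangeSum-vanishing w n (suc t) w≡0 = begin
    rangeSum w (n + suc t)             ≡⟨ cong (rangeSum w) (+-suc n t) ⟩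
    rangeSum w (n + t) + w (suc n + t) ≡⟨ cong₂ _+_ (rangeSum-vanishing w n t w≡0′) (w≡0 _ (s≤s (m≤m+n n t)) (≤-reflexive (sym (+-suc n t)))) ⟩
    rangeSum w n + 0                   ≡⟨ +-identityʳ _ ⟩
    rangeSum w n                       ∎
    where
    open ≡-Reasoning
    w≡0′ : ∀ e → n < e → e ≤ n + t → w e ≡ 0
    w≡0′ e n<e e≤n+t = w≡0 e n<e (≤-trans e≤n+t (+-monoʳ-≤ n (n≤1+n t)))

  rangeSum-≥-first : ∀ w n → w 1 ≤ rangeSum w (suc n)
  rangeSum-≥-first w zero    = ≤-refl
  rangeSum-≥-first w (suc n) = ≤-trans (rangeSum-≥-first w n) (m≤m+n _ _)

  strictly-between-multiples⇒∤ : ∀ p n e → .{{_ : NonZero p}} → p * n < e → e < p * suc n → ¬ p ∣ e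
  strictly-between-multiples⇒∤ p n e pn<e e<psn (divides q refl) =
    <⇒≱ (*-cancelˡ-< p n q (subst (p * n <_) (*-comm q p) pn<e))
        (s≤s⁻¹ (*-cancelˡ-< p q (suc n) (subst (_< p * suc n) (*-comm q p) e<psn)))

  rangeSum-multiples : ∀ p w n → .{{_ : NonZero p}} → (∀ e → ¬ p ∣ e → w e ≡ 0) →
                       rangeSum w (p * n) ≡ rangeSum (w ∘ (p *_)) n
  rangeSum-multiples p w zero    w≡0 = cong (rangeSum w) (*-zeroʳ p)
  rangeSum-multiples p@(suc p′) w (suc n) w≡0 = begin
    rangeSum w (p * suc n)                     ≡⟨ cong (rangeSum w) p[1+n]≡1+pn+p′ ⟩
    rangeSum w (p * n + p′) + w (suc (p * n + p′))
      ≡⟨ cong₂ _+_ (rangeSum-vanishing w (p * n) p′ gap) (cong w (sym p[1+n]≡1+pn+p′)) ⟩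
    rangeSum w (p * n) + w (p * suc n)         ≡⟨ cong (_+ w (p * suc n)) (rangeSum-multiples p w n w≡0) ⟩
    rangeSum (w ∘ (p *_)) (suc n)              ∎
    where
    open ≡-Reasoning
    p[1+n]≡1+pn+p′ : p * suc n ≡ suc (p * n + p′)
    p[1+n]≡1+pn+p′ = trans (*-suc p n) (trans (+-comm p (p * n)) (+-suc (p * n) p′))
    gap : ∀ e → p * n < e → e ≤ p * n + p′ → w e ≡ 0
    gap e pn<e e≤pn+p′ = w≡0 e (strictly-between-multiples⇒∤ p n e pn<e
                           (≤-<-trans e≤pn+p′ (subst (p * n + p′ <_) (sym p[1+n]≡1+pn+p′) (n<1+n _))))

  rangeSum-filter : ∀ {P : Pred ℕ 0ℓ} (P? : Decidable P) n →
                    sum (filter P? (applyUpTo suc n)) ≡ rangeSum (λ e → if does (P? e) then e else 0) n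
  rangeSum-filter P? zero    = refl
  rangeSum-filter P? (suc n) = begin
    sum (filter P? (applyUpTo suc (suc n)))             ≡⟨ cong (sum ∘ filter P?) (applyUpTo-∷ʳ suc n) ⟨
    sum (filter P? (applyUpTo suc n ++ suc n ∷ []))     ≡⟨ cong sum (filter-++ P? (applyUpTo suc n) (suc n ∷ [])) ⟩
    sum (filter P? (applyUpTo suc n) ++ filter P? (suc n ∷ []))
      ≡⟨ sum-++ (filter P? (applyUpTo suc n)) _ ⟩
    sum (filter P? (applyUpTo suc n)) + sum (filter P? (suc n ∷ []))
      ≡⟨ cong₂ _+_ (rangeSum-filter P? n) (sum-singleton-filter (suc n)) ⟩
    rangeSum (λ e → if does (P? e) then e else 0) (suc n) ∎
    where
    open ≡-Reasoning
    sum-singleton-filter : ∀ x → sum (filter P? (x ∷ [])) ≡ (if does (P? x) then x else 0)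
    sum-singleton-filter x with P? x
    ... | yes _ = +-identityʳ x
    ... | no  _ = refl

  if-does-cong : ∀ {A B : Set} (a : Dec A) (b : Dec B) {x y : ℕ} → (A → B) → (B → A) →
                 (if does a then x else y) ≡ (if does b then x else y)
  if-does-cong (yes _) (yes _) A→B B→A = refl
  if-does-cong (yes a) (no ¬b) A→B B→A = ⊥-elim (¬b (A→B a))
  if-does-cong (no ¬a) (yes b) A→B B→A = ⊥-elim (¬a (B→A b))
  if-does-cong (no _)  (no _)  A→B B→A = refl

  σ-term : ℕ → ℕ → ℕ
  σ-term N e = if does (e ∣? N) then e else 0

  σ≡rangeSum : ∀ N → σ N ≡ rangeSum (σ-term N) N
  σ≡rangeSum N = rangeSum-filter (_∣? N) N

  σ-term-> : ∀ N e → .{{NonZero N}} → N < e → σ-term N e ≡ 0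
  σ-term-> N e N<e with e ∣? N
  ... | yes e∣N = ⊥-elim (<⇒≱ N<e (∣⇒≤ e∣N))
  ... | no  _   = refl

  σ-term-divisor : ∀ {N e} → e ∣ N → σ-term N e ≡ e
  σ-term-divisor {N} {e} e∣N with e ∣? N
  ... | yes _   = refl
  ... | no  e∤N = ⊥-elim (e∤N e∣N)

  σ-term-∣ σ-term-∤ : ℕ → ℕ → ℕ → ℕ
  σ-term-∣ p N e = if does (p ∣? e) then σ-term N e else 0
  σ-term-∤ p N e = if does (p ∣? e) then 0 else σ-term N e

  σ-term-∤-> : ∀ p N e → .{{NonZero N}} → N < e → σ-term-∤ p N e ≡ 0
  σ-term-∤-> p N e N<e with p ∣? e
  ... | yes _ = refl
  ... | no  _ = σ-term-> N e N<e

  σ-term-split : ∀ p N e → σ-term N e ≡ σ-term-∣ p N e + σ-term-∤ p N e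
  σ-term-split p N e with p ∣? e
  ... | yes _ = sym (+-identityʳ _)
  ... | no  _ = refl

  σ-term-∣-∤ : ∀ {p} N e → ¬ p ∣ e → σ-term-∣ p N e ≡ 0
  σ-term-∣-∤ {p} N e p∤e with p ∣? e
  ... | yes p∣e = ⊥-elim (p∤e p∣e)
  ... | no  _   = refl

  σ-term-∣-* : ∀ p N → .{{_ : NonZero p}} → ∀ f → σ-term-∣ p (p * N) (p * f) ≡ p * σ-term N f
  σ-term-∣-* p N f with p ∣? p * f
  ... | no p∤pf = ⊥-elim (p∤pf (m∣m*n f))
  ... | yes _ with f ∣? N
  ...   | yes f∣N = if-does-cong (p * f ∣? p * N) (yes f∣N) (*-cancelˡ-∣ p) (*-monoʳ-∣ p)
  ...   | no  f∤N = trans (if-does-cong (p * f ∣? p * N) (no f∤N) (*-cancelˡ-∣ p) (*-monoʳ-∣ p))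
                          (sym (*-zeroʳ p))

  prime∤⇒coprime : ∀ {p e} → Prime p → ¬ p ∣ e → Coprime e p
  prime∤⇒coprime pp p∤e (c∣e , c∣p) with prime⇒irreducible pp c∣p
  ... | inj₁ c≡1  = c≡1
  ... | inj₂ refl = ⊥-elim (p∤e c∣e)

  σ-term-∤-* : ∀ {p} N e → Prime p → σ-term-∤ p (p * N) e ≡ σ-term-∤ p N e
  σ-term-∤-* {p} N e pp with p ∣? e
  ... | yes _   = refl
  ... | no  p∤e = if-does-cong (e ∣? p * N) (e ∣? N)
                    (coprime-divisor (prime∤⇒coprime pp p∤e)) (λ e∣N → ∣-trans e∣N (n∣m*n p))

  σ∤ : ℕ → ℕ → ℕ
  σ∤ p N = rangeSum (σ-term-∤ p N) N

  σ∤-extend : ∀ p N → .{{_ : NonZero p}} → .{{_ : NonZero N}} → rangeSum (σ-term-∤ p N) (p * N) ≡ σ∤ p N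
  σ∤-extend p@(suc p′) N = rangeSum-vanishing (σ-term-∤ p N) N (p′ * N) (λ e N<e _ → σ-term-∤-> p N e N<e)

  -- Divisors of pN split into p times the divisors of N, and the divisors of N prime to p.
  σ-* : ∀ {p} N → Prime p → .{{_ : NonZero N}} → σ (p * N) ≡ p * σ N + σ∤ p N
  σ-* {p} N pp = begin
    σ (p * N)                                          ≡⟨ σ≡rangeSum (p * N) ⟩
    rangeSum (σ-term (p * N)) (p * N)                  ≡⟨ rangeSum-cong (p * N) (σ-term-split p (p * N)) ⟩
    rangeSum (λ e → σ-term-∣ p (p * N) e + σ-term-∤ p (p * N) e) (p * N)
      ≡⟨ rangeSum-+ (σ-term-∣ p (p * N)) (σ-term-∤ p (p * N)) (p * N) ⟩
    rangeSum (σ-term-∣ p (p * N)) (p * N) + rangeSum (σ-term-∤ p (p * N)) (p * N)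
      ≡⟨ cong₂ _+_ (rangeSum-multiples p (σ-term-∣ p (p * N)) N (σ-term-∣-∤ (p * N)))
                   (rangeSum-cong (p * N) (λ e → σ-term-∤-* N e pp)) ⟩
    rangeSum (λ f → σ-term-∣ p (p * N) (p * f)) N + rangeSum (σ-term-∤ p N) (p * N)
      ≡⟨ cong₂ _+_ (rangeSum-cong N (σ-term-∣-* p N)) (σ∤-extend p N) ⟩
    rangeSum (λ f → p * σ-term N f) N + σ∤ p N         ≡⟨ cong (_+ σ∤ p N) (rangeSum-* p (σ-term N) N) ⟩
    p * rangeSum (σ-term N) N + σ∤ p N                 ≡⟨ cong (λ s → p * s + σ∤ p N) (σ≡rangeSum N) ⟨
    p * σ N + σ∤ p N                                   ∎
    where
    open ≡-Reasoning
    instance _ = prime⇒nonZero pp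

  σ∤-* : ∀ {p} N → Prime p → .{{_ : NonZero N}} → σ∤ p (p * N) ≡ σ∤ p N
  σ∤-* {p} N pp = trans (rangeSum-cong (p * N) (λ e → σ-term-∤-* N e pp)) (σ∤-extend p N)
    where instance _ = prime⇒nonZero pp

  σ∤-coprime : ∀ {p} m → ¬ p ∣ m → σ∤ p m ≡ σ m
  σ∤-coprime {p} m p∤m = trans (rangeSum-cong m all-prime-to-p) (sym (σ≡rangeSum m))
    where
    all-prime-to-p : ∀ e → σ-term-∤ p m e ≡ σ-term m e
    all-prime-to-p e with p ∣? e
    ... | no  _   = refl
    ... | yes p∣e with e ∣? m
    ...   | yes e∣m = ⊥-elim (p∤m (∣-trans p∣e e∣m))
    ...   | no  _   = refl

  repunit : ℕ → ℕ → ℕ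
  repunit p zero    = 1
  repunit p (suc k) = p * repunit p k + 1

  repunit≢0 : ∀ p k → NonZero (repunit p k)
  repunit≢0 p zero    = _
  repunit≢0 p (suc k) = subst NonZero (+-comm 1 (p * repunit p k)) _

  *-repunit≢0 : ∀ n p k → .{{NonZero n}} → NonZero (n * repunit p k)
  *-repunit≢0 n p k = m*n≢0 n (repunit p k)
    where instance _ = repunit≢0 p k

  ∤repunit : ∀ {p} k → 2 ≤ p → ¬ p ∣ repunit p k
  ∤repunit zero    2≤p p∣1         = <⇒≢ 2≤p (sym (∣1⇒≡1 p∣1))
  ∤repunit (suc k) 2≤p p∣pr+1      = <⇒≢ 2≤p (sym (∣1⇒≡1 (∣m+n∣m⇒∣n p∣pr+1 (m∣m*n _))))

  module _ {p m : ℕ} (pp : Prime p) .{{_ : NonZero m}} (p∤m : ¬ p ∣ m) where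

    private
      p^k*m≢0 : ∀ k → NonZero (p ^ k * m)
      p^k*m≢0 k = m*n≢0 (p ^ k) m {{m^n≢0 p k {{prime⇒nonZero pp}}}}

    σ∤-prime-power-* : ∀ k → σ∤ p (p ^ k * m) ≡ σ m
    σ∤-prime-power-* zero    = trans (cong (σ∤ p) (*-identityˡ m)) (σ∤-coprime m p∤m)
    σ∤-prime-power-* (suc k) = begin
      σ∤ p (p ^ suc k * m) ≡⟨ cong (σ∤ p) (*-assoc p (p ^ k) m) ⟩
      σ∤ p (p * (p ^ k * m)) ≡⟨ σ∤-* (p ^ k * m) pp {{p^k*m≢0 k}} ⟩
      σ∤ p (p ^ k * m)     ≡⟨ σ∤-prime-power-* k ⟩
      σ m                  ∎
      where open ≡-Reasoning

    σ-prime-power-* : ∀ k → σ (p ^ k * m) ≡ repunit p k * σ m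
    σ-prime-power-* zero    = trans (cong σ (*-identityˡ m)) (sym (*-identityˡ (σ m)))
    σ-prime-power-* (suc k) = begin
      σ (p ^ suc k * m)                          ≡⟨ cong σ (*-assoc p (p ^ k) m) ⟩
      σ (p * (p ^ k * m))                        ≡⟨ σ-* (p ^ k * m) pp {{p^k*m≢0 k}} ⟩
      p * σ (p ^ k * m) + σ∤ p (p ^ k * m)       ≡⟨ cong₂ (λ s t → p * s + t) (σ-prime-power-* k) (σ∤-prime-power-* k) ⟩
      p * (repunit p k * σ m) + σ m              ≡⟨ distrib p (repunit p k) (σ m) ⟩
      (p * repunit p k + 1) * σ m                ∎
      where
      open ≡-Reasoning
      distrib : ∀ a b c → a * (b * c) + c ≡ (a * b + 1) * c
      distrib = solve-∀

  σ-prime-power : ∀ {p} k → Prime p → σ (p ^ k) ≡ repunit p k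
  σ-prime-power {p} k p-prime = begin
    σ (p ^ k)          ≡⟨ cong σ (*-identityʳ (p ^ k)) ⟨
    σ (p ^ k * 1)      ≡⟨ σ-prime-power-* p-prime (∤repunit 0 (nonTrivial⇒n>1 p {{prime⇒nonTrivial p-prime}})) k ⟩
    repunit p k * 1    ≡⟨ *-identityʳ (repunit p k) ⟩
    repunit p k        ∎
    where open ≡-Reasoning

  -- 1 and e itself are distinct divisors of e.
  σ>self : ∀ e → 2 ≤ e → e < σ e
  σ>self 1 (s≤s ())
  σ>self e@(suc (suc e′)) _ = begin-strict
    e                                               <⟨ n<1+n e ⟩
    1 + e                                           ≡⟨ cong₂ _+_ (σ-term-divisor (1∣ e)) (σ-term-divisor ∣-refl) ⟨
    σ-term e 1 + σ-term e e                         ≤⟨ +-monoˡ-≤ (σ-term e e) (rangeSum-≥-first (σ-term e) e′) ⟩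
    rangeSum (σ-term e) (suc e′) + σ-term e e       ≡⟨ σ≡rangeSum e ⟨
    σ e                                             ∎
    where open ≤-Reasoning

  σ≡self⇒≡1 : ∀ e → .{{NonZero e}} → σ e ≡ e → e ≡ 1
  σ≡self⇒≡1 1                 _    = refl
  σ≡self⇒≡1 e@(suc (suc _)) σe≡e = ⊥-elim (<-irrefl (sym σe≡e) (σ>self e (s≤s (s≤s z≤n))))

module PrimePowers where

  open import Data.Nat
  open import Data.Nat.Divisibility
  open import Data.Nat.Induction using (<-wellFounded)
  open import Data.Nat.Primality
  open import Data.Nat.Properties
  open import Induction.WellFounded using (Acc; acc)

  cofactor<value : ∀ {p k d d′} → 2 ≤ p → .{{_ : NonZero d′}} → d ≡ p ^ suc k * d′ → d′ < d
  cofactor<value {p} {k} {d} {d′} 2≤p d≡p^[1+k]*d′ = begin-strict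
    d′              <⟨ m<m*n d′ p 2≤p ⟩
    d′ * p          ≤⟨ *-monoʳ-≤ d′ (m≤m*n p (p ^ k) {{m^n≢0 p k {{p≢0}}}}) ⟩
    d′ * p ^ suc k  ≡⟨ *-comm d′ (p ^ suc k) ⟩
    p ^ suc k * d′  ≡⟨ d≡p^[1+k]*d′ ⟨
    d               ∎
    where
    open ≤-Reasoning
    p≢0 : NonZero p
    p≢0 = >-nonZero (≤-trans (s≤s z≤n) 2≤p)

  record PrimePowerSplit (p d : ℕ) : Set where
    field
      exponent cofactor : ℕ
      d≡p^[1+k]*d′      : d ≡ p ^ suc exponent * cofactor
      p∤cofactor        : ¬ p ∣ cofactor
      cofactor≢0        : NonZero cofactor

  primePowerSplit : ∀ {p d} → 2 ≤ p → .{{NonZero d}} → p ∣ d → PrimePowerSplit p d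
  primePowerSplit {p} {d} 2≤p = split d (<-wellFounded d)
    where
    split : ∀ d → Acc _<_ d → .{{NonZero d}} → p ∣ d → PrimePowerSplit p d
    split d _ (divides zero d≡0) = ⊥-elim (≢-nonZero⁻¹ d d≡0)
    split d (acc smaller) (divides q@(suc _) d≡qp) with p ∣? q
    ... | no p∤q = record
      { exponent = 0 ; cofactor = q ; p∤cofactor = p∤q ; cofactor≢0 = _
      ; d≡p^[1+k]*d′ = trans d≡qp (trans (*-comm q p) (cong (_* q) (sym (*-identityʳ p)))) }
    ... | yes p∣q = record
      { exponent = suc exponent ; cofactor = cofactor ; p∤cofactor = p∤cofactor ; cofactor≢0 = cofactor≢0
      ; d≡p^[1+k]*d′ = begin
          d                               ≡⟨ d≡qp ⟩
          q * p                           ≡⟨ *-comm q p ⟩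
          p * q                           ≡⟨ cong (p *_) d≡p^[1+k]*d′ ⟩
          p * (p ^ suc exponent * cofactor) ≡⟨ *-assoc p (p ^ suc exponent) cofactor ⟨
          p ^ suc (suc exponent) * cofactor ∎ }
      where
      open ≡-Reasoning
      q<d : q < d
      q<d = subst (q <_) (sym d≡qp) (m<m*n q p 2≤p)
      open PrimePowerSplit (split q (smaller q<d) p∣q)

  leastPrimeFactor : ∀ {m d} → 2 ≤ m → m Rough d → 2 ≤ d → ∃[ p ] (Prime p × m ≤ p × p ∣ d × p Rough d)
  leastPrimeFactor {m} {d} 2≤m m-rough 2≤d =
    search (d ∸ m) m (m+[n∸m]≡n (rough⇒≤ {{n>1⇒nonTrivial 2≤d}} m-rough)) 2≤m m-rough
    where
    search : ∀ t m → m + t ≡ d → 2 ≤ m → m Rough d → ∃[ p ] (Prime p × m ≤ p × p ∣ d × p Rough d)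
    search t m m+t≡d 2≤m m-rough with m ∣? d
    ... | yes m∣d = m , rough∧∣⇒prime {{n>1⇒nonTrivial 2≤m}} m-rough m∣d , ≤-refl , m∣d , m-rough
    search zero    m m+0≡d _ _ | no m∤d = ⊥-elim (m∤d (subst (m ∣_) (trans (sym (+-identityʳ m)) m+0≡d) ∣-refl))
    search (suc t) m m+1+t≡d 2≤m m-rough | no m∤d
      with search t (suc m) (trans (sym (+-suc m t)) m+1+t≡d) (m≤n⇒m≤1+n 2≤m) (∤⇒rough-suc m∤d m-rough)
    ... | p , p-prime , 1+m≤p , p∣d , p-rough = p , p-prime , ≤-trans (n≤1+n m) 1+m≤p , p∣d , p-rough

  record LeastPrimePower (m d : ℕ) : Set where
    field
      p              : ℕ
      p-prime        : Prime p
      m≤p            : m ≤ p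
      split          : PrimePowerSplit p d
      cofactor-rough : suc p Rough PrimePowerSplit.cofactor split

  leastPrimePower : ∀ {m d} → 2 ≤ m → m Rough d → 2 ≤ d → LeastPrimePower m d
  leastPrimePower {m} {d} 2≤m m-rough 2≤d with leastPrimeFactor 2≤m m-rough 2≤d
  ... | p , p-prime , m≤p , p∣d , p-rough = record
    { p = p ; p-prime = p-prime ; m≤p = m≤p ; split = split
    ; cofactor-rough = ∤⇒rough-suc p∤cofactor (rough∧∣⇒rough p-rough (divides (p ^ suc exponent) d≡p^[1+k]*d′)) }
    where
    instance d≢0 : NonZero d
    d≢0 = >-nonZero (≤-trans (s≤s z≤n) 2≤d)
    split = primePowerSplit (nonTrivial⇒n>1 p {{prime⇒nonTrivial p-prime}}) p∣d
    open PrimePowerSplit split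

open DivisorSum
open PrimePowers

import Data.Integer as ℤ
import Data.Integer.Properties as ℤ
open import Data.List.Membership.Propositional using (_∈_)
open import Data.List.Properties using (map-∘; map-cong-local)
open import Data.List.Relation.Unary.All.Properties using (¬Any⇒All¬; all-filter; filter⁺; map⁺)
import Data.List.Relation.Unary.AllPairs.Properties as AllPairs
open import Data.List.Relation.Unary.Any as Any using (Any; any?)
import Data.List.Relation.Unary.Unique.Propositional.Properties as Unique
open import Data.Nat as ℕ using (zero; suc; _^_; _≟_; NonZero; pred; s≤s; z≤n)
import Data.Nat.Properties as ℕ
open import Data.List.Membership.DecPropositional ℕ._≟_ using (_∈?_)
open import Data.Nat.Divisibility using (_∣_; divides; ∣-trans; m∣m*n; n∣m*n)
open import Data.Nat.ListAction using (product)
open import Data.Nat.ListAction.Properties using (∈⇒≤product)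
open import Data.Nat.Primality using (Prime; _Rough_; 2-rough; rough∧∣⇒rough; euclidsLemma; prime⇒nonTrivial)
open import Data.Nat.Tactic.RingSolver using (solve-∀)
open import Data.Rational using (ℚ; Positive; _≤_; 0ℚ; 1ℚ; _+_; _*_; toℚᵘ; nonNegative)
open import Data.Rational.Properties
  using (toℚᵘ-injective; toℚᵘ-cancel-≤; toℚᵘ-fromℚᵘ; toℚᵘ-homo-+; toℚᵘ-homo-*; normalize-nonNeg; normalize-injective-≃;
         nonNegative⁻¹; nonNeg*nonNeg⇒nonNeg; +-comm; +-assoc; +-identityˡ; +-identityʳ; *-comm; *-identityˡ; *-identityʳ;
         *-zeroʳ; *-distribˡ-+; *-distribʳ-+; +-mono-≤; *-monoˡ-≤-nonNeg; ≤-trans; ≤-reflexive; module ≤-Reasoning)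
open import Data.Rational.Unnormalised as ℚᵘ using (ℚᵘ; mkℚᵘ; *≡*; *≤*)
import Data.Rational.Unnormalised.Properties as ℚᵘ

private
  infix 8 _÷_
  _÷_ : ℕ → (b : ℕ) → .{{NonZero b}} → ℚᵘ
  a ÷ b = ℤ.+ a ℚᵘ./ b

  ÷-≃ : ∀ a b c d .{{_ : NonZero b}} .{{_ : NonZero d}} → a ℕ.* d ≡ c ℕ.* b → a ÷ b ℚᵘ.≃ c ÷ d
  ÷-≃ a (suc b) c (suc d) ad≡cb = *≡* (trans (sym (ℤ.pos-* a (suc d))) (trans (cong ℤ.+_ ad≡cb) (ℤ.pos-* c (suc b))))

  ÷-≤ : ∀ a b c d .{{_ : NonZero b}} .{{_ : NonZero d}} → a ℕ.* d ℕ.≤ c ℕ.* b → a ÷ b ℚᵘ.≤ c ÷ d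
  ÷-≤ a (suc b) c (suc d) ad≤cb = *≤* (subst₂ ℤ._≤_ (ℤ.pos-* a (suc d)) (ℤ.pos-* c (suc b)) (ℤ.+≤+ ad≤cb))

  ÷-+ : ∀ a b c d .{{_ : NonZero b}} .{{_ : NonZero d}} →
        a ÷ b ℚᵘ.+ c ÷ d ℚᵘ.≃ ((a ℕ.* d ℕ.+ c ℕ.* b) ÷ (b ℕ.* d)) {{ℕ.m*n≢0 b d}}
  ÷-+ a (suc b) c (suc d) = ℚᵘ.≃-reflexive (cong (λ n → mkℚᵘ n (d ℕ.+ b ℕ.* suc d)) numerator)
    where
    numerator : ℤ.+ a ℤ.* ℤ.+ suc d ℤ.+ ℤ.+ c ℤ.* ℤ.+ suc b ≡ ℤ.+ (a ℕ.* suc d ℕ.+ c ℕ.* suc b)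
    numerator = trans (cong₂ ℤ._+_ (sym (ℤ.pos-* a (suc d))) (sym (ℤ.pos-* c (suc b))))
                      (sym (ℤ.pos-+ (a ℕ.* suc d) _))

  ÷-* : ∀ a b c d .{{_ : NonZero b}} .{{_ : NonZero d}} →
        a ÷ b ℚᵘ.* c ÷ d ℚᵘ.≃ ((a ℕ.* c) ÷ (b ℕ.* d)) {{ℕ.m*n≢0 b d}}
  ÷-* a (suc b) c (suc d) = ℚᵘ.≃-reflexive (cong (λ n → mkℚᵘ n (d ℕ.+ b ℕ.* suc d)) (sym (ℤ.pos-* a c)))

  toℚᵘ-recip : ∀ n .{{_ : NonZero n}} → toℚᵘ (recip n) ℚᵘ.≃ 1 ÷ n
  toℚᵘ-recip (suc n) = toℚᵘ-fromℚᵘ (mkℚᵘ (ℤ.+ 1) n)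

recip-nonNeg : ∀ n → 0ℚ ≤ recip n
recip-nonNeg zero    = nonNegative⁻¹ 0ℚ
recip-nonNeg (suc n) = nonNegative⁻¹ _ {{normalize-nonNeg 1 (suc n)}}

recip-antitone : ∀ {a b} .{{_ : NonZero a}} → a ℕ.≤ b → recip b ≤ recip a
recip-antitone {suc _} {zero}      ()
recip-antitone {a@(suc _)} {b@(suc _)} a≤b = toℚᵘ-cancel-≤ (begin
  toℚᵘ (recip b) ≃⟨ toℚᵘ-recip b ⟩
  1 ÷ b          ≤⟨ ÷-≤ 1 b 1 a (ℕ.*-monoʳ-≤ 1 a≤b) ⟩
  1 ÷ a          ≃⟨ toℚᵘ-recip a ⟨
  toℚᵘ (recip a) ∎)
  where open ℚᵘ.≤-Reasoning

recip-* : ∀ a b .{{_ : NonZero a}} .{{_ : NonZero b}} → recip (a ℕ.* b) ≡ recip a * recip b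
recip-* a@(suc _) b@(suc _) = toℚᵘ-injective (begin
  toℚᵘ (recip (a ℕ.* b))                  ≈⟨ toℚᵘ-recip (a ℕ.* b) ⟩
  1 ÷ (a ℕ.* b)                           ≈⟨ ÷-* 1 a 1 b ⟨
  1 ÷ a ℚᵘ.* 1 ÷ b                        ≈⟨ ℚᵘ.*-cong (toℚᵘ-recip a) (toℚᵘ-recip b) ⟨
  toℚᵘ (recip a) ℚᵘ.* toℚᵘ (recip b)      ≈⟨ toℚᵘ-homo-* (recip a) (recip b) ⟨
  toℚᵘ (recip a * recip b)                ∎)
  where open ℚᵘ.≃-Reasoning

recip-telescope : ∀ P′ x .{{_ : NonZero P′}} .{{_ : NonZero x}} →
                  recip (suc P′ ℕ.* x) + recip (suc P′ ℕ.* x) * recip P′ ≡ recip x * recip P′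
recip-telescope P′@(suc _) x@(suc _) = toℚᵘ-injective (begin
  toℚᵘ (r (P ℕ.* x) + r (P ℕ.* x) * r P′)
    ≈⟨ ℚᵘ.≃-trans (toℚᵘ-homo-+ (r (P ℕ.* x)) _) (ℚᵘ.+-congʳ (toℚᵘ (r (P ℕ.* x))) (toℚᵘ-homo-* (r (P ℕ.* x)) (r P′))) ⟩
  toℚᵘ (r (P ℕ.* x)) ℚᵘ.+ toℚᵘ (r (P ℕ.* x)) ℚᵘ.* toℚᵘ (r P′)
    ≈⟨ ℚᵘ.+-cong (toℚᵘ-recip (P ℕ.* x)) (ℚᵘ.*-cong (toℚᵘ-recip (P ℕ.* x)) (toℚᵘ-recip P′)) ⟩
  1 ÷ (P ℕ.* x) ℚᵘ.+ 1 ÷ (P ℕ.* x) ℚᵘ.* 1 ÷ P′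
    ≈⟨ ℚᵘ.+-congʳ (1 ÷ (P ℕ.* x)) (÷-* 1 (P ℕ.* x) 1 P′) ⟩
  1 ÷ (P ℕ.* x) ℚᵘ.+ 1 ÷ (P ℕ.* x ℕ.* P′)
    ≈⟨ ÷-+ 1 (P ℕ.* x) 1 (P ℕ.* x ℕ.* P′) ⟩
  _ ≈⟨ ÷-≃ _ _ 1 (x ℕ.* P′) (cross P′ x) ⟩
  1 ÷ (x ℕ.* P′)                          ≈⟨ ÷-* 1 x 1 P′ ⟨
  1 ÷ x ℚᵘ.* 1 ÷ P′                       ≈⟨ ℚᵘ.*-cong (toℚᵘ-recip x) (toℚᵘ-recip P′) ⟨
  toℚᵘ (r x) ℚᵘ.* toℚᵘ (r P′)             ≈⟨ toℚᵘ-homo-* (r x) (r P′) ⟨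
  toℚᵘ (r x * r P′)                       ∎)
  where
  open ℚᵘ.≃-Reasoning
  r = recip
  P = suc P′
  cross : ∀ P′ x → (1 ℕ.* (suc P′ ℕ.* x ℕ.* P′) ℕ.+ 1 ℕ.* (suc P′ ℕ.* x)) ℕ.* (x ℕ.* P′)
                 ≡ 1 ℕ.* (suc P′ ℕ.* x ℕ.* (suc P′ ℕ.* x ℕ.* P′))
  cross = solve-∀

recip-telescope₁ : ∀ P′ .{{_ : NonZero P′}} → recip P′ * recip (suc P′) + recip (suc P′) ≡ recip P′
recip-telescope₁ P′ = begin
  recip P′ * recip P + recip P                 ≡⟨ +-comm (recip P′ * recip P) (recip P) ⟩
  recip P + recip P′ * recip P                 ≡⟨ cong (λ y → recip P + y) (*-comm (recip P′) (recip P)) ⟩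
  recip P + recip P * recip P′                 ≡⟨ cong (λ y → recip y + recip y * recip P′) (ℕ.*-identityʳ P) ⟨
  recip (P ℕ.* 1) + recip (P ℕ.* 1) * recip P′ ≡⟨ recip-telescope P′ 1 ⟩
  recip 1 * recip P′                           ≡⟨ *-identityˡ (recip P′) ⟩
  recip P′                                     ∎
  where
  open ≡-Reasoning
  P = suc P′

∑ : ∀ {X : Set} → (X → ℚ) → List X → ℚ
∑ w xs = sumℚ (map w xs)

∑-map : ∀ {X Y : Set} (w : Y → ℚ) (f : X → Y) xs → ∑ w (map f xs) ≡ ∑ (w ∘ f) xs
∑-map w f xs = cong sumℚ (sym (map-∘ xs))

map-proj₁-toList : ∀ {X : Set} {P : X → Set} {xs} (pxs : All P xs) → map proj₁ (All.toList pxs) ≡ xs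
map-proj₁-toList []         = refl
map-proj₁-toList (px ∷ pxs) = cong (_ ∷_) (map-proj₁-toList pxs)

∑-toList : ∀ {X : Set} {P : X → Set} (w : X → ℚ) {xs} (pxs : All P xs) → ∑ w xs ≡ ∑ (w ∘ proj₁) (All.toList pxs)
∑-toList w pxs = trans (cong (∑ w) (sym (map-proj₁-toList pxs))) (∑-map w proj₁ (All.toList pxs))

∑-factor : ∀ {X : Set} (w v : X → ℚ) c {xs} → All (λ x → w x ≡ c * v x) xs → ∑ w xs ≡ c * ∑ v xs
∑-factor w v c []            = sym (*-zeroʳ c)
∑-factor w v c {x ∷ xs} (w≡cv ∷ w≡cvs) = begin
  w x + ∑ w xs         ≡⟨ cong₂ _+_ w≡cv (∑-factor w v c w≡cvs) ⟩
  c * v x + c * ∑ v xs ≡⟨ *-distribˡ-+ c (v x) (∑ v xs) ⟨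
  c * ∑ v (x ∷ xs)     ∎
  where open ≡-Reasoning

∑-partition : ∀ {X : Set} {P : Pred X 0ℓ} (w : X → ℚ) (P? : Decidable P) xs →
              ∑ w xs ≡ ∑ w (filter P? xs) + ∑ w (filter (¬? ∘ P?) xs)
∑-partition w P? []       = sym (+-identityˡ 0ℚ)
∑-partition w P? (x ∷ xs) with P? x
... | yes _ = trans (cong (w x +_) (∑-partition w P? xs)) (sym (+-assoc (w x) _ _))
... | no  _ = begin
  w x + ∑ w xs    ≡⟨ cong (w x +_) (∑-partition w P? xs) ⟩
  w x + (s + t)   ≡⟨ +-assoc (w x) s t ⟨
  (w x + s) + t   ≡⟨ cong (_+ t) (+-comm (w x) s) ⟩
  (s + w x) + t   ≡⟨ +-assoc s (w x) t ⟩
  s + (w x + t)   ∎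
  where
  open ≡-Reasoning
  s = ∑ w (filter P? xs)
  t = ∑ w (filter (¬? ∘ P?) xs)

filter-filter-⊆ : ∀ {X : Set} {P Q : Pred X 0ℓ} (P? : Decidable P) (Q? : Decidable Q) →
                  (∀ {x} → P x → Q x) → ∀ xs → filter P? (filter Q? xs) ≡ filter P? xs
filter-filter-⊆ P? Q? P⇒Q []       = refl
filter-filter-⊆ P? Q? P⇒Q (x ∷ xs) with Q? x
... | yes _ with P? x
...   | yes _ = cong (x ∷_) (filter-filter-⊆ P? Q? P⇒Q xs)
...   | no  _ = filter-filter-⊆ P? Q? P⇒Q xs
filter-filter-⊆ P? Q? P⇒Q (x ∷ xs) | no ¬Qx with P? x
...   | yes Px = ⊥-elim (¬Qx (P⇒Q Px))
...   | no  _  = filter-filter-⊆ P? Q? P⇒Q xs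

module _ {X : Set} (w : X → ℚ) (key : X → ℕ) where

  private
    group : ℕ → List X → List X
    group k = filter (λ x → key x ≟ k)

    others : ℕ → List X → List X
    others k = filter (λ x → ¬? (key x ≟ k))

    keys-bounded : ∀ xs → ∃ λ t → All (λ x → key x ℕ.< t) xs
    keys-bounded []       = 0 , []
    keys-bounded (x ∷ xs) with keys-bounded xs
    ... | t , bounded = suc (key x) ℕ.+ t ,
                        ℕ.m≤m+n (suc (key x)) t ∷ All.map (λ {y} y<t → ℕ.≤-trans y<t (ℕ.m≤n+m t _)) bounded

  ∑-≤-telescoping : (G B : ℕ → ℚ) (a : ℕ) →
                    (∀ k → a ℕ.≤ k → G k + B (suc k) ≤ B k) → (∀ k → a ℕ.≤ k → 0ℚ ≤ B k) →
                    ∀ xs → All (λ x → a ℕ.≤ key x) xs →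
                    (∀ k → a ℕ.≤ k → ∑ w (filter (λ x → key x ≟ k) xs) ≤ G k) →
                    ∑ w xs ≤ B a
  ∑-≤-telescoping G B a telescope B≥0 xs a≤keys groups≤G with keys-bounded xs
  ... | t , bounded = go t a telescope B≥0 xs
                         (All.zipWith (λ (a≤k , k<t) → a≤k , ℕ.<-≤-trans k<t (ℕ.m≤n+m t a)) (a≤keys , bounded))
                         groups≤G
    where
    go : ∀ t a → (∀ k → a ℕ.≤ k → G k + B (suc k) ≤ B k) → (∀ k → a ℕ.≤ k → 0ℚ ≤ B k) →
         ∀ xs → All (λ x → a ℕ.≤ key x × key x ℕ.< a ℕ.+ t) xs → (∀ k → a ℕ.≤ k → ∑ w (group k xs) ≤ G k) →
         ∑ w xs ≤ B a
    go zero a _ B≥0 []       _                  _ = B≥0 a ℕ.≤-refl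
    go zero a _ _   (x ∷ _)  ((a≤k , k<a) ∷ _) _ = ⊥-elim (ℕ.<⇒≱ k<a (subst (ℕ._≤ key x) (sym (ℕ.+-identityʳ a)) a≤k))
    go (suc t) a telescope B≥0 xs bounds groups≤G = begin
      ∑ w xs                                   ≡⟨ ∑-partition w (λ x → key x ≟ a) xs ⟩
      ∑ w (group a xs) + ∑ w (others a xs)     ≤⟨ +-mono-≤ (groups≤G a ℕ.≤-refl) rest≤ ⟩
      G a + B (suc a)                          ≤⟨ telescope a ℕ.≤-refl ⟩
      B a                                      ∎
      where
      open ≤-Reasoning
      rest-bounds : All (λ x → suc a ℕ.≤ key x × key x ℕ.< suc a ℕ.+ t) (others a xs)
      rest-bounds = All.zipWith (λ { {x} ((a≤k , k<a+1+t) , k≢a) → ℕ.≤∧≢⇒< a≤k (k≢a ∘ sym) , subst (key x ℕ.<_) (ℕ.+-suc a t) k<a+1+t })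
                                (filter⁺ (λ x → ¬? (key x ≟ a)) bounds , all-filter (λ x → ¬? (key x ≟ a)) xs)
      group-others : ∀ k → a ℕ.< k → group k (others a xs) ≡ group k xs
      group-others k a<k = filter-filter-⊆ (λ x → key x ≟ k) (λ x → ¬? (key x ≟ a)) (λ { refl refl → ℕ.<-irrefl refl a<k }) xs
      rest≤ : ∑ w (others a xs) ≤ B (suc a)
      rest≤ = go t (suc a) (λ k → telescope k ∘ ℕ.<⇒≤) (λ k → B≥0 k ∘ ℕ.<⇒≤) (others a xs) rest-bounds
                 (λ k a<k → subst (_≤ G k) (cong (∑ w) (sym (group-others k a<k))) (groups≤G k (ℕ.<⇒≤ a<k)))

*-nonNeg : ∀ {p q} → 0ℚ ≤ p → 0ℚ ≤ q → 0ℚ ≤ p * q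
*-nonNeg {p} {q} 0≤p 0≤q = nonNegative⁻¹ _ {{nonNeg*nonNeg⇒nonNeg p {{nonNegative 0≤p}} q {{nonNegative 0≤q}}}}

unique-map-filter : ∀ {X : Set} {P : Pred X 0ℓ} (f : X → ℕ) (P? : Decidable P) {xs} →
                    Unique (map f xs) → Unique (map f (filter P? xs))
unique-map-filter f P? = AllPairs.map⁺ ∘ AllPairs.filter⁺ P? ∘ AllPairs.map⁻

unique-map-via : ∀ {X : Set} (f g : X → ℕ) (h : ℕ → ℕ) {xs} → All (λ x → f x ≡ h (g x)) xs →
                 Unique (map f xs) → Unique (map g xs)
unique-map-via f g h {xs} f≡h∘g = Unique.map⁻ {f = h} ∘ subst Unique (trans (map-cong-local f≡h∘g) (map-∘ xs))

module _ {X : Set} (value exponent cofactor : X → ℕ) where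

  -- The group of exponent k contributes at most c / Pᵏ⁺¹, and Σₖ c / Pᵏ⁺¹ = c / (P - 1).
  ∑-prime-power-layer : ∀ P → 2 ℕ.≤ P → (c : ℚ) → 0ℚ ≤ c → (Q : ℕ → ℕ → Set) →
      (∀ k {ys} → Unique ys → All (Q k) ys → ∑ recip ys ≤ c) →
      ∀ {xs} → Unique (map value xs) →
      All (λ x → value x ≡ P ^ suc (exponent x) ℕ.* cofactor x × NonZero (cofactor x) × Q (exponent x) (cofactor x)) xs →
      ∑ (recip ∘ value) xs ≤ recip (pred P) * c
  ∑-prime-power-layer P@(suc P′@(suc _)) (s≤s (s≤s z≤n)) c 0≤c Q cofactors≤c {xs} unique-values items = begin
    ∑ (recip ∘ value) xs             ≤⟨ ∑-≤-telescoping (recip ∘ value) exponent G B 0 telescope B≥0 xs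
                                          (All.tabulate (λ _ → z≤n)) group≤G ⟩
    recip 1 * recip P′ * c           ≡⟨ cong (_* c) (*-identityˡ (recip P′)) ⟩
    recip P′ * c                     ∎
    where
    open ≤-Reasoning
    G B : ℕ → ℚ
    G k = recip (P ^ suc k) * c
    B k = recip (P ^ k) * recip P′ * c

    telescope : ∀ k → 0 ℕ.≤ k → G k + B (suc k) ≤ B k
    telescope k _ = ≤-reflexive (begin-equality
      recip (P ^ suc k) * c + recip (P ^ suc k) * recip P′ * c   ≡⟨ *-distribʳ-+ c (recip (P ^ suc k)) (recip (P ^ suc k) * recip P′) ⟨
      (recip (P ^ suc k) + recip (P ^ suc k) * recip P′) * c      ≡⟨ cong (_* c) (recip-telescope P′ (P ^ k) {{_}} {{ℕ.m^n≢0 P k}}) ⟩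
      recip (P ^ k) * recip P′ * c                                ∎)

    B≥0 : ∀ k → 0 ℕ.≤ k → 0ℚ ≤ B k
    B≥0 k _ = *-nonNeg (*-nonNeg (recip-nonNeg (P ^ k)) (recip-nonNeg P′)) 0≤c

    group≤G : ∀ k → 0 ℕ.≤ k → ∑ (recip ∘ value) (filter (λ x → exponent x ≟ k) xs) ≤ G k
    group≤G k _ = begin
      ∑ (recip ∘ value) group                          ≡⟨ ∑-factor (recip ∘ value) (recip ∘ cofactor) (recip (P ^ suc k))
                                                            (All.map recip-value in-group) ⟩
      recip (P ^ suc k) * ∑ (recip ∘ cofactor) group   ≡⟨ cong (recip (P ^ suc k) *_) (∑-map recip cofactor group) ⟨
      recip (P ^ suc k) * ∑ recip (map cofactor group) ≤⟨ *-monoˡ-≤-nonNeg (recip (P ^ suc k))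
                                                            {{nonNegative (recip-nonNeg (P ^ suc k))}} cofactors≤c′ ⟩
      G k                                              ∎
      where
      group = filter (λ x → exponent x ≟ k) xs
      InGroup : X → Set
      InGroup x = value x ≡ P ^ suc k ℕ.* cofactor x × NonZero (cofactor x) × Q k (cofactor x)

      in-group : All InGroup group
      in-group = All.zipWith (λ { (facts , refl) → facts })
                   (filter⁺ (λ x → exponent x ≟ k) items , all-filter (λ x → exponent x ≟ k) xs)

      recip-value : ∀ {x} → InGroup x → recip (value x) ≡ recip (P ^ suc k) * recip (cofactor x)
      recip-value {x} (value≡ , cofactor≢0 , _) =
        trans (cong recip value≡) (recip-* (P ^ suc k) (cofactor x) {{ℕ.m^n≢0 P (suc k)}} {{cofactor≢0}})

      cofactors≤c′ : ∑ recip (map cofactor group) ≤ c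
      cofactors≤c′ = cofactors≤c k
        (unique-map-via value cofactor (P ^ suc k ℕ.*_) (All.map proj₁ in-group)
          (unique-map-filter value (λ x → exponent x ≟ k) unique-values))
        (map⁺ (All.map (proj₂ ∘ proj₂) in-group))

record Solution (n m A B d : ℕ) : Set where
  field
    d≢0   : NonZero d
    d≤n   : d ℕ.≤ n
    rough : m Rough d
    ratio : σ d ℕ.* B ≡ A ℕ.* d

module _ {n m A B d : ℕ} (sol : Solution n m A B d) where
  open Solution sol

  Solution-cross : ∀ {n′ m′ e} .{{_ : NonZero B}} → Solution n′ m′ A B e → σ d ℕ.* e ≡ σ e ℕ.* d
  Solution-cross {e = e} sol′ = ℕ.*-cancelʳ-≡ (σ d ℕ.* e) (σ e ℕ.* d) B (begin
    σ d ℕ.* e ℕ.* B   ≡⟨ swap (σ d) e B ⟩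
    σ d ℕ.* B ℕ.* e   ≡⟨ cong (ℕ._* e) ratio ⟩
    A ℕ.* d ℕ.* e     ≡⟨ swap A d e ⟩
    A ℕ.* e ℕ.* d     ≡⟨ cong (ℕ._* d) (Solution.ratio sol′) ⟨
    σ e ℕ.* B ℕ.* d   ≡⟨ swap (σ e) B d ⟩
    σ e ℕ.* d ℕ.* B   ∎)
    where
    open ≡-Reasoning
    swap : ∀ x y z → x ℕ.* y ℕ.* z ≡ x ℕ.* z ℕ.* y
    swap = solve-∀

module _ {n m A B p d : ℕ} (p-prime : Prime p) (sol : Solution (suc n) m A B d) (s : PrimePowerSplit p d) where
  open Solution sol
  open PrimePowerSplit s

  -- Dividing out pᵏ⁺¹ multiplies the abundancy by pᵏ⁺¹ / σ(pᵏ⁺¹).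
  Solution-cofactor : ∀ {m′} → m′ Rough cofactor →
                      Solution n m′ (A ℕ.* p ^ suc exponent) (B ℕ.* repunit p (suc exponent)) cofactor
  Solution-cofactor m′-rough = record
    { d≢0   = cofactor≢0
    ; d≤n   = ℕ.≤-pred (ℕ.≤-trans (cofactor<value {k = exponent} 2≤p {{cofactor≢0}} d≡p^[1+k]*d′) d≤n)
    ; rough = m′-rough
    ; ratio = begin
        σ cofactor ℕ.* (B ℕ.* r)       ≡⟨ rearrange (σ cofactor) B r ⟩
        r ℕ.* σ cofactor ℕ.* B         ≡⟨ cong (ℕ._* B) (σ-prime-power-* p-prime {{cofactor≢0}} p∤cofactor (suc exponent)) ⟨
        σ (P ℕ.* cofactor) ℕ.* B       ≡⟨ cong (λ x → σ x ℕ.* B) d≡p^[1+k]*d′ ⟨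
        σ d ℕ.* B                      ≡⟨ ratio ⟩
        A ℕ.* d                        ≡⟨ cong (A ℕ.*_) d≡p^[1+k]*d′ ⟩
        A ℕ.* (P ℕ.* cofactor)         ≡⟨ ℕ.*-assoc A P cofactor ⟨
        A ℕ.* P ℕ.* cofactor           ∎ }
    where
    open ≡-Reasoning
    P = p ^ suc exponent
    r = repunit p (suc exponent)
    2≤p = ℕ.nonTrivial⇒n>1 p {{prime⇒nonTrivial p-prime}}
    rearrange : ∀ x y z → x ℕ.* (y ℕ.* z) ≡ z ℕ.* x ℕ.* y
    rearrange = solve-∀

-- σ(pᵏ⁺¹) is prime to p, so p must divide every d of the same abundancy as pᵏ⁺¹.
prime-power-solution-divides : ∀ {n m n′ m′ A B p k d} .{{_ : NonZero B}} → Prime p →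
                               Solution n m A B (p ^ suc k) → Solution n′ m′ A B d → p ∣ d
prime-power-solution-divides {p = p} {k} {d} p-prime sol₀ sol
  with euclidsLemma (repunit p (suc k)) d p-prime p∣repunit*d
  where
  p∣repunit*d : p ∣ repunit p (suc k) ℕ.* d
  p∣repunit*d = subst (p ∣_) (trans (Solution-cross sol sol₀) (cong (ℕ._* d) (σ-prime-power (suc k) p-prime)))
                      (∣-trans (m∣m*n (p ^ k)) (n∣m*n (σ d)))
... | inj₁ p∣repunit = ⊥-elim (∤repunit (suc k) (ℕ.nonTrivial⇒n>1 p {{prime⇒nonTrivial p-prime}}) p∣repunit)
... | inj₂ p∣d       = p∣d

NontrivialBound TotalBound : ℕ → Set
NontrivialBound n = ∀ {m A B} .{{_ : NonZero B}} → 2 ℕ.≤ m → ∀ {ds} → Unique ds →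
                    All (λ d → Solution n m A B d × 2 ℕ.≤ d) ds → ∑ recip ds ≤ recip (pred m)
TotalBound n = ∀ {m A B} .{{_ : NonZero B}} → 2 ℕ.≤ m → ∀ {ds} → Unique ds →
               All (Solution n m A B) ds → ∑ recip ds ≤ 1ℚ

∑-unique-ones : ∀ {ds} → Unique ds → All (_≡ 1) ds → ∑ recip ds ≤ 1ℚ
∑-unique-ones {[]}        _                 _                  = recip-nonNeg 1
∑-unique-ones {1 ∷ []}    _                 (refl ∷ [])        = ≤-reflexive (+-identityʳ 1ℚ)
∑-unique-ones {_ ∷ _ ∷ _} ((1≢1 ∷ _) ∷ _) (refl ∷ refl ∷ _) = ⊥-elim (1≢1 refl)

nonZero∧≢1⇒≥2 : ∀ d → NonZero d → d ≢ 1 → 2 ℕ.≤ d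
nonZero∧≢1⇒≥2 1               _ d≢1 = ⊥-elim (d≢1 refl)
nonZero∧≢1⇒≥2 (suc (suc _)) _ _   = s≤s (s≤s z≤n)

-- If 1 is a solution then A = B, and σ(d) = d forces d = 1 for every other solution.
total-bound : ∀ {n} → NontrivialBound n → TotalBound n
total-bound {n} nontrivial {m} {A} {B} 2≤m {ds} unique sols with 1 ∈? ds
... | yes 1∈ds = ∑-unique-ones unique (All.map all-one sols)
  where
  B≡A : B ≡ A
  B≡A = trans (sym (ℕ.+-identityʳ B)) (trans (Solution.ratio (All.lookup sols 1∈ds)) (ℕ.*-identityʳ A))
  all-one : ∀ {d} → Solution n m A B d → d ≡ 1
  all-one {d} sol = σ≡self⇒≡1 d {{d≢0}} (ℕ.*-cancelʳ-≡ (σ d) d B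
                      (trans ratio (trans (cong (ℕ._* d) (sym B≡A)) (ℕ.*-comm B d))))
    where open Solution sol
... | no 1∉ds = ≤-trans (nontrivial 2≤m unique (All.zipWith at-least-2 (sols , ¬Any⇒All¬ ds 1∉ds)))
                        (recip-antitone (ℕ.pred-mono-≤ 2≤m))
  where
  at-least-2 : ∀ {d} → Solution n m A B d × ¬ 1 ≡ d → Solution n m A B d × 2 ℕ.≤ d
  at-least-2 {d} (sol , 1≢d) = sol , nonZero∧≢1⇒≥2 d (Solution.d≢0 sol) (1≢d ∘ sym)

bound-with-prime-power : ∀ {n m A B p k} .{{_ : NonZero B}} → TotalBound n → 2 ℕ.≤ m → Prime p → m ℕ.≤ p →
                         Solution (suc n) m A B (p ^ suc k) →
                         ∀ {ds} → Unique ds → All (Solution (suc n) m A B) ds → ∑ recip ds ≤ recip (pred m)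
bound-with-prime-power {n} {m} {A} {B} {p} {k} total 2≤m p-prime m≤p sol₀ {ds} unique sols = begin
  ∑ recip ds                    ≡⟨ ∑-toList recip sols-splits ⟩
  ∑ (recip ∘ proj₁) items       ≤⟨ ∑-prime-power-layer proj₁ splitExponent splitCofactor p 2≤p 1ℚ (recip-nonNeg 1) Q
                                      (λ k → total {{*-repunit≢0 B p (suc k)}} 2≤m)
                                      (subst Unique (sym (map-proj₁-toList sols-splits)) unique)
                                      (All.tabulate (λ {x} _ → item-facts x)) ⟩
  recip (pred p) * 1ℚ           ≡⟨ *-identityʳ (recip (pred p)) ⟩
  recip (pred p)                ≤⟨ recip-antitone {{pred≢0}} (ℕ.pred-mono-≤ m≤p) ⟩
  recip (pred m)                ∎
  where
  open ≤-Reasoning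
  2≤p = ℕ.nonTrivial⇒n>1 p {{prime⇒nonTrivial p-prime}}
  pred≢0 : NonZero (pred m)
  pred≢0 = ℕ.>-nonZero (ℕ.pred-mono-≤ 2≤m)

  sols-splits : All (λ d → Solution (suc n) m A B d × PrimePowerSplit p d) ds
  sols-splits = All.map (λ sol → sol , primePowerSplit 2≤p {{Solution.d≢0 sol}}
                                         (prime-power-solution-divides {k = k} p-prime sol₀ sol)) sols
  items = All.toList sols-splits

  Item = ∃ λ d → Solution (suc n) m A B d × PrimePowerSplit p d
  splitExponent splitCofactor : Item → ℕ
  splitExponent = PrimePowerSplit.exponent ∘ proj₂ ∘ proj₂
  splitCofactor = PrimePowerSplit.cofactor ∘ proj₂ ∘ proj₂

  Q : ℕ → ℕ → Set
  Q k = Solution n m (A ℕ.* p ^ suc k) (B ℕ.* repunit p (suc k))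

  item-facts : ∀ x → proj₁ x ≡ p ^ suc (splitExponent x) ℕ.* splitCofactor x × NonZero (splitCofactor x) ×
                   Q (splitExponent x) (splitCofactor x)
  item-facts (d , sol , s) =
    d≡p^[1+k]*d′ , cofactor≢0 , Solution-cofactor p-prime sol s (rough∧∣⇒rough (Solution.rough sol) cofactor∣d)
    where
    open PrimePowerSplit s
    cofactor∣d : cofactor ∣ d
    cofactor∣d = divides (p ^ suc exponent) d≡p^[1+k]*d′

FactoredSolution : ℕ → ℕ → ℕ → ℕ → ℕ → Set
FactoredSolution n m A B d = Solution n m A B d × LeastPrimePower m d

module _ {n m A B : ℕ} where
  primeOf exponentOf cofactorOf : ∃ (FactoredSolution n m A B) → ℕ
  primeOf    (_ , _ , lpp) = LeastPrimePower.p lpp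
  exponentOf (_ , _ , lpp) = PrimePowerSplit.exponent (LeastPrimePower.split lpp)
  cofactorOf (_ , _ , lpp) = PrimePowerSplit.cofactor (LeastPrimePower.split lpp)

-- Group by the least prime P ≥ m: the cofactors in a group are (P + 1)-rough and ≥ 2, so each group
-- contributes at most 1/(P (P - 1)), and these telescope to 1/(m - 1).
bound-without-prime-power : ∀ {n m A B} .{{_ : NonZero B}} → NontrivialBound n → 2 ℕ.≤ m →
                            (items : List (∃ (FactoredSolution (suc n) m A B))) → Unique (map proj₁ items) →
                            All (λ x → cofactorOf x ≢ 1) items → ∑ (recip ∘ proj₁) items ≤ recip (pred m)
bound-without-prime-power {n} {m} {A} {B} nontrivial 2≤m items unique cofactors≢1 =
  ∑-≤-telescoping (recip ∘ proj₁) primeOf G B′ m telescope (λ P _ → recip-nonNeg (pred P)) items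
    (All.tabulate (λ { {_ , _ , lpp} _ → LeastPrimePower.m≤p lpp })) group≤G
  where
  G B′ : ℕ → ℚ
  G P  = recip (pred P) * recip P
  B′ P = recip (pred P)

  telescope : ∀ P → m ℕ.≤ P → G P + B′ (suc P) ≤ B′ P
  telescope P m≤P with ℕ.≤-trans 2≤m m≤P
  ... | s≤s (s≤s _) = ≤-reflexive (recip-telescope₁ (pred P))

  Q : ℕ → ℕ → ℕ → Set
  Q P k d′ = Solution n (suc P) (A ℕ.* P ^ suc k) (B ℕ.* repunit P (suc k)) d′ × 2 ℕ.≤ d′

  Item = ∃ (FactoredSolution (suc n) m A B)

  item-facts : ∀ P (x : Item) → primeOf x ≡ P → cofactorOf x ≢ 1 →
               proj₁ x ≡ P ^ suc (exponentOf x) ℕ.* cofactorOf x × NonZero (cofactorOf x) × Q P (exponentOf x) (cofactorOf x)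
  item-facts _ (d , sol , lpp) refl cofactor≢1 =
    d≡p^[1+k]*d′ , cofactor≢0 , Solution-cofactor p-prime sol split cofactor-rough , nonZero∧≢1⇒≥2 cofactor cofactor≢0 cofactor≢1
    where
    open LeastPrimePower lpp
    open PrimePowerSplit split

  group≤G : ∀ P → m ℕ.≤ P → ∑ (recip ∘ proj₁) (filter (λ (x : Item) → primeOf x ≟ P) items) ≤ G P
  group≤G P m≤P = ∑-prime-power-layer proj₁ exponentOf cofactorOf P 2≤P (recip P) (recip-nonNeg P) (Q P)
                    (λ k → nontrivial {{*-repunit≢0 B P (suc k)}} (s≤s (ℕ.≤-trans (s≤s z≤n) 2≤P)))
                    (unique-map-filter proj₁ (λ (x : Item) → primeOf x ≟ P) unique)
                    (All.zipWith (λ { {x} (p≡P , cofactor≢1) → item-facts P x p≡P cofactor≢1 })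
                                 (all-filter (λ (x : Item) → primeOf x ≟ P) items , filter⁺ (λ (x : Item) → primeOf x ≟ P) cofactors≢1))
    where 2≤P = ℕ.≤-trans 2≤m m≤P

nontrivial-bound : ∀ n → NontrivialBound n
nontrivial-bound zero {m} _ {[]}  _ []              = recip-nonNeg (pred m)
nontrivial-bound zero    _ {d ∷ _} _ ((sol , _) ∷ _) =
  ⊥-elim (ℕ.≢-nonZero⁻¹ d {{Solution.d≢0 sol}} (ℕ.n≤0⇒n≡0 (Solution.d≤n sol)))
nontrivial-bound (suc n) {m} {A} {B} 2≤m {ds} unique sols = by-cases (any? (λ x → cofactorOf x ≟ 1) items)
  where
  factored : All (FactoredSolution (suc n) m A B) ds
  factored = All.map (λ (sol , 2≤d) → sol , leastPrimePower 2≤m (Solution.rough sol) 2≤d) sols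
  items = All.toList factored

  by-cases : Dec (Any (λ x → cofactorOf x ≡ 1) items) → ∑ recip ds ≤ recip (pred m)
  by-cases (yes some-prime-power) with Any.satisfied some-prime-power
  ... | (d₀ , sol₀ , lpp₀) , cofactor≡1 =
    bound-with-prime-power {k = exponent} (total-bound (nontrivial-bound n)) 2≤m p-prime m≤p
      (subst (Solution (suc n) m A B) d₀≡p^[1+k] sol₀) unique (All.map proj₁ sols)
    where
    open LeastPrimePower lpp₀
    open PrimePowerSplit split
    d₀≡p^[1+k] : d₀ ≡ p ^ suc exponent
    d₀≡p^[1+k] = trans d≡p^[1+k]*d′ (trans (cong (p ^ suc exponent ℕ.*_) cofactor≡1) (ℕ.*-identityʳ _))
  by-cases (no no-prime-power) = begin
    ∑ recip ds               ≡⟨ ∑-toList recip factored ⟩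
    ∑ (recip ∘ proj₁) items  ≤⟨ bound-without-prime-power (nontrivial-bound n) 2≤m items
                                  (subst Unique (sym (map-proj₁-toList factored)) unique) (¬Any⇒All¬ items no-prime-power) ⟩
    recip (pred m)           ∎
    where open ≤-Reasoning

abundancy-cross : ∀ d e .{{_ : NonZero d}} .{{_ : NonZero e}} → abundancy d ≡ abundancy e → σ d ℕ.* e ≡ σ e ℕ.* d
abundancy-cross d@(suc _) e@(suc _) = normalize-injective-≃ (σ d) (σ e) d e

mainTheorem11 : (q : ℚ) → Positive q →
    (ds : List ℕ) → Unique ds →
    All (λ d → (d ≢ 0) × (abundancy d ≡ q)) ds →
    sumℚ (map recip ds) ≤ 1ℚ
mainTheorem11 q _ []        _      _                         = recip-nonNeg 1
mainTheorem11 q _ (d₀ ∷ ds) unique hyps@((d₀≢0 , d₀↦q) ∷ _) =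
  total-bound (nontrivial-bound bound) {{ℕ.≢-nonZero d₀≢0}} ℕ.≤-refl unique (All.tabulate solution)
  where
  bound = product (d₀ ∷ ds)
  solution : ∀ {d} → d ∈ d₀ ∷ ds → Solution bound 2 (σ d₀) d₀ d
  solution d∈ds with All.lookup hyps d∈ds
  ... | d≢0 , d↦q = record
    { d≢0   = ℕ.≢-nonZero d≢0
    ; d≤n   = ∈⇒≤product (All.map (ℕ.≢-nonZero ∘ proj₁) hyps) d∈ds
    ; rough = 2-rough
    ; ratio = abundancy-cross _ d₀ {{ℕ.≢-nonZero d≢0}} {{ℕ.≢-nonZero d₀≢0}} (trans d↦q (sym d₀↦q)) }
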